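{- Let $D$ be a barrier and $f$ a function defined on $D$ such that $f(d_1)=f(d_2)$ whenever $d_1,d_2\in D$ and $d_1\triangleleft d_2$. Then $f$ is constant on $D$.
   Context: A barrier is an infinite set $B\subseteq[\omega]^{<\omega}$ which is an antichain under $\subseteq$ and such that every infinite subset of its base $\bigcup B$ has an initial segment (the set of its $k$ smallest elements for some $k$) in $B$. For $r,s\in[\omega]^{<\omega}$ with $r\ne\emptyset$, $r\triangleleft s$ means $\min r<\min s$ and $r\setminus\{\min r\}$ is a proper initial segment of $s$. -}

module Defs where

open import Data.Nat using (ℕ; _<_)
open import Data.List using (List; []; _∷_; _++_; map; upTo)
open import Data.List.Membership.Propositional using (_∈_; _∉_)
open import Data.List.Relation.Unary.Linked using (Linked)
open import Data.Product using (Σ; ∃; ∃-syntax; _×_)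
open import Relation.Binary.PropositionalEquality using (_≡_)

-- Finite subsets of ω are represented by strictly increasing lists of ℕ
-- (a bijective representation: each finite set has exactly one such list).
Family : Set₁
Family = List ℕ → Set

_⊆ₛ_ : List ℕ → List ℕ → Set
s ⊆ₛ t = ∀ x → x ∈ s → x ∈ t

_∈Base_ : ℕ → Family → Set
x ∈Base B = ∃[ s ] (B s × x ∈ s)

-- An infinite subset of ω, given by its strictly increasing enumeration g.
StrictIncr : (ℕ → ℕ) → Set
StrictIncr g = ∀ n → g n < g (Data.Nat.suc n)

initSeg : (ℕ → ℕ) → ℕ → List ℕ
initSeg g k = map g (upTo k)

InfiniteFamily : Family → Set
InfiniteFamily B = ∀ (L : List (List ℕ)) → ∃[ s ] (B s × s ∉ L)

record IsBarrier (B : Family) : Set where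
  field
    sorted     : ∀ s → B s → Linked _<_ s
    infinite   : InfiniteFamily B
    antichain  : ∀ s t → B s → B t → s ⊆ₛ t → s ≡ t
    initial    : ∀ (g : ℕ → ℕ) → StrictIncr g → (∀ n → g n ∈Base B) →
                 ∃[ k ] B (initSeg g k)

-- r ◁ s : r ≠ ∅, min r < min s, and r \ {min r} is a proper initial
-- segment of s (for increasing lists: a proper list prefix of s).
_◁_ : List ℕ → List ℕ → Set
r ◁ s = ∃[ a ] ∃[ r' ] ∃[ b ] ∃[ s' ]
          (r ≡ a ∷ r' × s ≡ b ∷ s' × a < b ×
           ∃[ c ] ∃[ u ] (r' ++ (c ∷ u) ≡ s))

-- Fix an increasing enumeration h of the base lying above both given members, and a
-- member h↾k* of D which is an initial segment of h (it exists since D is a barrier).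
-- Any two members of D that are initial segments of the same sequence coincide, so f
-- takes the value f (h↾k*) on every member that is an initial segment of h.  Now
-- prepend a point a < h 0: if a member of D is an initial segment of a ∷ g, it is
-- (a ∷ g↾k) for some k, and the member g↾j of D given by the barrier property must
-- have j > k (otherwise g↾j ⊆ a ∷ g↾k, which the antichain condition forbids).  Then
-- (a ∷ g↾k) ◁ g↾j, so the value of f carries over from g to a ∷ g.  Prepending the
-- elements of a member d of D one by one, d itself is an initial segment of d ++ h.
module Submission where

open import Defs
open import Data.Nat using (ℕ; zero; suc; _+_; _<_; _≤_; _≤?_; _<?_; z≤n; s≤s)
open import Data.Nat.Properties
  using ( ≤-total; ≤-trans; ≤-<-trans; <-trans; ≮⇒≥; ≰⇒>; <⇒≱; <⇒≢; ≤∧≢⇒<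
        ; +-suc; +-identityʳ; _≟_)
open import Data.Nat.GeneralisedArithmetic using (fold)
open import Data.List using (List; []; _∷_; _++_; [_]; map; length; applyUpTo)
open import Data.List.Properties using (map-upTo; ∷-injectiveˡ)
open import Data.List.Extrema.Nat using (max; xs≤max)
open import Data.List.Membership.Propositional using (_∈_; find)
open import Data.List.Membership.Propositional.Properties
  using (∈-applyUpTo⁺; ∈-applyUpTo⁻; ∈-++⁺ˡ; ∈-++⁺ʳ; ∈-map⁺)
open import Data.List.Relation.Unary.Any using (here; there)
open import Data.List.Relation.Unary.All as All using (All; []; _∷_)
open import Data.List.Relation.Unary.All.Properties using (¬All⇒Any¬; ++⁻ˡ; ++⁻ʳ)
open import Data.List.Relation.Unary.AllPairs using (AllPairs; []; _∷_)
open import Data.List.Relation.Unary.Linked.Properties using (Linked⇒AllPairs)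
open import Data.List.Relation.Binary.Sublist.Propositional using (_⊆_; []; _∷_; _∷ʳ_; minimum)
open import Data.Product using (∃-syntax; _×_; _,_; proj₁; proj₂)
open import Data.Empty using (⊥-elim)
open import Data.Sum using (inj₁; inj₂)
open import Relation.Nullary using (¬_; yes; no; contradiction)
open import Relation.Binary.PropositionalEquality
  using (_≡_; _≢_; refl; sym; trans; cong; subst; module ≡-Reasoning)

applyUpTo-mono : ∀ (g : ℕ → ℕ) {j k} → j ≤ k → applyUpTo g j ⊆ₛ applyUpTo g k
applyUpTo-mono g j≤k x x∈ with ∈-applyUpTo⁻ g x∈
... | i , i<j , refl = ∈-applyUpTo⁺ g (≤-trans i<j j≤k)

applyUpTo-prefix : ∀ (g : ℕ → ℕ) {j k} → j < k →
                   ∃[ c ] ∃[ u ] (applyUpTo g j ++ c ∷ u ≡ applyUpTo g k)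
applyUpTo-prefix g {zero} {suc k} _ = g 0 , applyUpTo (λ i → g (suc i)) k , refl
applyUpTo-prefix g {suc j} {suc k} (s≤s j<k) with applyUpTo-prefix (λ i → g (suc i)) j<k
... | c , u , eq = c , u , cong (g 0 ∷_) eq

∷-◁-applyUpTo : ∀ (g : ℕ → ℕ) {a j k} → a < g 0 → k < j → (a ∷ applyUpTo g k) ◁ applyUpTo g j
∷-◁-applyUpTo g {a} {suc j} {k} a<g₀ k<j =
  a , applyUpTo g k , g 0 , applyUpTo (λ i → g (suc i)) j , refl , refl , a<g₀ ,
  applyUpTo-prefix g k<j

infixr 5 _∷ₛ_ _++ₛ_

_∷ₛ_ : ℕ → (ℕ → ℕ) → ℕ → ℕ
(a ∷ₛ g) zero = a
(a ∷ₛ g) (suc n) = g n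

_++ₛ_ : List ℕ → (ℕ → ℕ) → ℕ → ℕ
[] ++ₛ g = g
(a ∷ p) ++ₛ g = a ∷ₛ (p ++ₛ g)

applyUpTo-++ₛ-length : ∀ p g → applyUpTo (p ++ₛ g) (length p) ≡ p
applyUpTo-++ₛ-length [] g = refl
applyUpTo-++ₛ-length (a ∷ p) g = cong (a ∷_) (applyUpTo-++ₛ-length p g)

++ₛ-head : ∀ {P : ℕ → Set} {p g} → All P p → P (g 0) → P ((p ++ₛ g) 0)
++ₛ-head [] Pg₀ = Pg₀
++ₛ-head (Pa ∷ _) _ = Pa

∷ₛ-strictIncr : ∀ {a g} → a < g 0 → StrictIncr g → StrictIncr (a ∷ₛ g)
∷ₛ-strictIncr a<g₀ _ zero = a<g₀
∷ₛ-strictIncr _ g-incr (suc n) = g-incr n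

sublists : List ℕ → List (List ℕ)
sublists [] = [ [] ]
sublists (x ∷ xs) = sublists xs ++ map (x ∷_) (sublists xs)

sublists-complete : ∀ {s xs} → s ⊆ xs → s ∈ sublists xs
sublists-complete [] = here refl
sublists-complete (_∷ʳ_ {xs = s} x s⊆xs) = ∈-++⁺ˡ (sublists-complete s⊆xs)
sublists-complete {xs = x ∷ xs} (refl ∷ s⊆xs) =
  ∈-++⁺ʳ (sublists xs) (∈-map⁺ (x ∷_) (sublists-complete s⊆xs))

interval : ℕ → ℕ → List ℕ
interval m zero = []
interval m (suc k) = m ∷ interval (suc m) k

increasing⊆interval : ∀ k {m s} → AllPairs _<_ s → All (m ≤_) s → All (_< m + k) s →
                      s ⊆ interval m k
increasing⊆interval k {s = []} _ _ _ = minimum _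
increasing⊆interval zero {m} {x ∷ _} (_ ∷ _) (m≤x ∷ _) (x<m+0 ∷ _) =
  contradiction m≤x (<⇒≱ (subst (x <_) (+-identityʳ m) x<m+0))
increasing⊆interval (suc k) {m} {x ∷ s} (x<s ∷ s-incr) (m≤x ∷ _) s<m+1+k
  with m ≟ x | All.map (λ {y} → subst (y <_) (+-suc m k)) s<m+1+k
... | yes refl | _ ∷ s<1+m+k = refl ∷ increasing⊆interval k s-incr x<s s<1+m+k
... | no m≢x   | x∷s<1+m+k   =
  m ∷ʳ increasing⊆interval k (x<s ∷ s-incr) (m<x ∷ All.map (<-trans m<x) x<s) x∷s<1+m+k
  where m<x = ≤∧≢⇒< m≤x m≢x

module _ {D : Family} (B : IsBarrier D) where
  open IsBarrier B
  open ≡-Reasoning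

  []∉ : ¬ D []
  []∉ D[] with infinite [ [] ]
  ... | s , Ds , s∉ with antichain [] s D[] Ds (λ _ ())
  ... | refl = s∉ (here refl)

  -- D is infinite, but only finitely many increasing lists have all entries ≤ N.
  base-unbounded : ∀ N → ∃[ x ] (x ∈Base D × N < x)
  base-unbounded N with infinite (sublists (interval 0 (suc N)))
  ... | s , Ds , s∉ with All.all? (_≤? N) s
  ... | yes s≤N = contradiction (sublists-complete s⊆[0,N]) s∉
    where
    s⊆[0,N] : s ⊆ interval 0 (suc N)
    s⊆[0,N] = increasing⊆interval (suc N) (Linked⇒AllPairs <-trans (sorted s Ds))
                (All.tabulate (λ _ → z≤n)) (All.map s≤s s≤N)
  ... | no s≰N with find (¬All⇒Any¬ (_≤? N) s s≰N)
  ... | x , x∈s , x≰N = x , (s , Ds , x∈s) , ≰⇒> x≰N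

  IncreasingInBase : (ℕ → ℕ) → Set
  IncreasingInBase g = StrictIncr g × (∀ n → g n ∈Base D)

  increasingInBase-above : ∀ N → ∃[ h ] (IncreasingInBase h × N < h 0)
  increasingInBase-above N = h , (h-incr , h-base) , proj₂ (proj₂ (base-unbounded N))
    where
    next : ℕ → ℕ
    next x = proj₁ (base-unbounded x)
    h : ℕ → ℕ
    h n = next (fold N next n)
    h-incr : StrictIncr h
    h-incr n = proj₂ (proj₂ (base-unbounded (h n)))
    h-base : ∀ n → h n ∈Base D
    h-base n = proj₁ (proj₂ (base-unbounded (fold N next n)))

  ∷ₛ-increasingInBase : ∀ {a g} → a ∈Base D → a < g 0 → IncreasingInBase g →
                        IncreasingInBase (a ∷ₛ g)
  ∷ₛ-increasingInBase a∈ a<g₀ (g-incr , g-base) = ∷ₛ-strictIncr a<g₀ g-incr , λ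
    { zero → a∈ ; (suc n) → g-base n }

  ++ₛ-increasingInBase : ∀ {p h} → AllPairs _<_ p → All (_∈Base D) p → All (_< h 0) p →
                         IncreasingInBase h → IncreasingInBase (p ++ₛ h)
  ++ₛ-increasingInBase [] [] [] h-inc = h-inc
  ++ₛ-increasingInBase (a<p ∷ p-incr) (a∈ ∷ p∈) (a<h₀ ∷ p<h₀) h-inc =
    ∷ₛ-increasingInBase a∈ (++ₛ-head a<p a<h₀) (++ₛ-increasingInBase p-incr p∈ p<h₀ h-inc)

  initialSegment : ∀ {g} → IncreasingInBase g → ∃[ k ] D (applyUpTo g k)
  initialSegment {g} (g-incr , g-base) with initial g g-incr g-base
  ... | k , Dk = k , subst D (map-upTo g k) Dk

  initialSegment-unique : ∀ g {j k} → D (applyUpTo g j) → D (applyUpTo g k) →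
                          applyUpTo g j ≡ applyUpTo g k
  initialSegment-unique g {j} {k} Dj Dk with ≤-total j k
  ... | inj₁ j≤k = antichain _ _ Dj Dk (applyUpTo-mono g j≤k)
  ... | inj₂ k≤j = sym (antichain _ _ Dk Dj (applyUpTo-mono g k≤j))

  ∷-initialSegment-shorter : ∀ {g a j k} → a < g 0 →
                             D (a ∷ applyUpTo g k) → D (applyUpTo g j) → k < j
  ∷-initialSegment-shorter {g} {a} {j} {k} a<g₀ Dak Dj with k <? j
  ... | yes k<j = k<j
  ... | no k≮j = ⊥-elim (differs j Dj
        (antichain _ _ Dj Dak (λ x x∈ → there (applyUpTo-mono g (≮⇒≥ k≮j) x x∈))))
    where
    differs : ∀ j → D (applyUpTo g j) → applyUpTo g j ≢ a ∷ applyUpTo g k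
    differs zero D[] _ = []∉ D[]
    differs (suc j) _ eq = <⇒≢ a<g₀ (sym (∷-injectiveˡ eq))

  module _ {A : Set} (f : List ℕ → A) where

    ConstantAlong : (ℕ → ℕ) → A → Set
    ConstantAlong g c = ∀ k → D (applyUpTo g k) → f (applyUpTo g k) ≡ c

    constantAlong-initialSegment : ∀ g {k} → D (applyUpTo g k) →
                                   ConstantAlong g (f (applyUpTo g k))
    constantAlong-initialSegment g Dk j Dj = cong f (initialSegment-unique g Dj Dk)

    module _ (f-◁ : ∀ d₁ d₂ → D d₁ → D d₂ → d₁ ◁ d₂ → f d₁ ≡ f d₂) where

      ∷ₛ-constantAlong : ∀ {a g c} → a < g 0 → IncreasingInBase g → ConstantAlong g c →
                         ConstantAlong (a ∷ₛ g) c
      ∷ₛ-constantAlong _ _ _ zero D[] = ⊥-elim ([]∉ D[])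
      ∷ₛ-constantAlong {a} {g} {c} a<g₀ g-inc g-const (suc k) Dak with initialSegment g-inc
      ... | j , Dj = begin
        f (a ∷ applyUpTo g k) ≡⟨ f-◁ _ _ Dak Dj (∷-◁-applyUpTo g a<g₀ k<j) ⟩
        f (applyUpTo g j)     ≡⟨ g-const j Dj ⟩
        c                     ∎
        where k<j = ∷-initialSegment-shorter a<g₀ Dak Dj

      ++ₛ-constantAlong : ∀ {p h c} → AllPairs _<_ p → All (_∈Base D) p → All (_< h 0) p →
                          IncreasingInBase h → ConstantAlong h c → ConstantAlong (p ++ₛ h) c
      ++ₛ-constantAlong [] [] [] _ h-const = h-const
      ++ₛ-constantAlong (a<p ∷ p-incr) (_ ∷ p∈) (a<h₀ ∷ p<h₀) h-inc h-const =
        ∷ₛ-constantAlong (++ₛ-head a<p a<h₀) (++ₛ-increasingInBase p-incr p∈ p<h₀ h-inc)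
          (++ₛ-constantAlong p-incr p∈ p<h₀ h-inc h-const)

      member-value : ∀ {d h c} → D d → All (_< h 0) d → IncreasingInBase h →
                     ConstantAlong h c → f d ≡ c
      member-value {d} {h} Dd d<h₀ h-inc h-const =
        subst (λ e → f e ≡ _) (applyUpTo-++ₛ-length d h)
          (++ₛ-constantAlong (Linked⇒AllPairs <-trans (sorted d Dd))
            (All.tabulate (λ x∈ → d , Dd , x∈)) d<h₀ h-inc h-const (length d)
            (subst D (sym (applyUpTo-++ₛ-length d h)) Dd))

mainTheorem16 : (D : Family) → IsBarrier D → {A : Set} → (f : List ℕ → A) →
    (∀ d₁ d₂ → D d₁ → D d₂ → d₁ ◁ d₂ → f d₁ ≡ f d₂) →
    ∀ d₁ d₂ → D d₁ → D d₂ → f d₁ ≡ f d₂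
mainTheorem16 D B f f-◁ d₁ d₂ D₁ D₂ with increasingInBase-above B (max 0 (d₁ ++ d₂))
... | h , h-inc , N<h₀ with initialSegment B h-inc
... | k , Dk = trans (member-value B f f-◁ D₁ (++⁻ˡ d₁ below) h-inc h-const)
                     (sym (member-value B f f-◁ D₂ (++⁻ʳ d₁ below) h-inc h-const))
  where
  below : All (_< h 0) (d₁ ++ d₂)
  below = All.map (λ x≤N → ≤-<-trans x≤N N<h₀) (xs≤max 0 (d₁ ++ d₂))
  h-const : ConstantAlong B f h (f (applyUpTo h k))
  h-const = constantAlong-initialSegment B f h Dk
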